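{- Let $(L,Q_1,Q_2,\ldots,Q_n,R)$ be a $4$-flexipath in a matroid $M$. For distinct $i,j\in[n]$, $\lambda(Q_i\cup Q_j)\ge\lambda(Q_i)$.
   Context: Let $M$ be a matroid on ground set $E$ with rank function $r$; $\lambda(A)=r(A)+r(E-A)-r(M)$ for $A\subseteq E$, and $\kappa(X,Y)=\min\{\lambda(Z):X\subseteq Z\subseteq E-Y\}$ for disjoint $X,Y$. A path of $4$-separations in $M$ is an ordered partition $(L,P_1,\ldots,P_n,R)$ of $E$ with $\kappa(L,R)=3$ and $\lambda(L\cup P_1\cup\cdots\cup P_i)=3$ for all $i\in\{0,\ldots,n\}$. It is a $4$-flexipath if $(L,Q_1,\ldots,Q_n,R)$ is a path of $4$-separations for every permutation $(Q_1,\ldots,Q_n)$ of $(P_1,\ldots,P_n)$. -}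

module Defs where

open import Data.Nat using (ℕ; zero; suc; _+_; _∸_; _≤_)
open import Data.Fin using (Fin; zero; suc)
open import Data.Fin.Subset using (Subset; _⊆_; _∩_; _∪_; ∁; ⊤; ⊥; ∣_∣)
open import Data.Fin.Permutation using (Permutation′; _⟨$⟩ʳ_)
open import Data.Product using (Σ; _×_; _,_)
open import Relation.Binary.PropositionalEquality using (_≡_; _≢_)

record Matroid (m : ℕ) : Set where
  field
    r          : Subset m → ℕ
    r-bounded  : ∀ X → r X ≤ ∣ X ∣
    r-mono     : ∀ X Y → X ⊆ Y → r X ≤ r Y
    r-submod   : ∀ X Y → r (X ∪ Y) + r (X ∩ Y) ≤ r X + r Y

module _ {m : ℕ} (M : Matroid m) where
  open Matroid M

  -- connectivity function λ(A) = r(A) + r(E - A) - r(M)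
  -- (truncated subtraction is harmless: r(A)+r(E-A) ≥ r(E) by submodularity)
  conn : Subset m → ℕ
  conn A = (r A + r (∁ A)) ∸ r ⊤

  KappaIs : Subset m → Subset m → ℕ → Set
  KappaIs X Y k =
    Σ (Subset m) (λ Z → X ⊆ Z × Z ⊆ ∁ Y × conn Z ≡ k)
    × (∀ Z → X ⊆ Z → Z ⊆ ∁ Y → k ≤ conn Z)

unionUpTo : ∀ {m n} → (Fin n → Subset m) → ℕ → Subset m
unionUpTo {n = zero}  P i       = ⊥
unionUpTo {n = suc n} P zero    = ⊥
unionUpTo {n = suc n} P (suc i) = P zero ∪ unionUpTo (λ k → P (suc k)) i

Disjoint : ∀ {m} → Subset m → Subset m → Set
Disjoint A B = A ∩ B ≡ ⊥

IsOrderedPartition : ∀ {m n} → Subset m → (Fin n → Subset m) → Subset m → Set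
IsOrderedPartition {m} {n} L P R =
  Disjoint L R
  × (∀ i → Disjoint L (P i))
  × (∀ i → Disjoint (P i) R)
  × (∀ i j → i ≢ j → Disjoint (P i) (P j))
  × (L ∪ (unionUpTo P n ∪ R) ≡ ⊤)

IsPathOf4Seps : ∀ {m n} → Matroid m → Subset m → (Fin n → Subset m) → Subset m → Set
IsPathOf4Seps {m} {n} M L P R =
  IsOrderedPartition L P R
  × KappaIs M L R 3
  × (∀ i → i ≤ n → conn M (L ∪ unionUpTo P i) ≡ 3)

Is4Flexipath : ∀ {m n} → Matroid m → Subset m → (Fin n → Subset m) → Subset m → Set
Is4Flexipath {m} {n} M L P R =
  ∀ (σ : Permutation′ n) → IsPathOf4Seps M L (λ i → P (σ ⟨$⟩ʳ i)) R

{-# OPTIONS --safe #-}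
-- Put Q i first and Q j second: since the P's may be permuted freely, (L, Q i, Q j, …, R) is a
-- path of 4-separations, so λ(L ∪ Q i) = λ(L ∪ Q i ∪ Q j) = 3. Submodularity of λ applied to
-- L ∪ Q i and Q i ∪ Q j, whose meet is Q i by disjointness of L and Q j, gives
-- λ(L ∪ Q i ∪ Q j) + λ(Q i) ≤ λ(L ∪ Q i) + λ(Q i ∪ Q j), and the two equal terms cancel.
module Submission where

open import Defs
open import Data.Nat using (ℕ; suc; _≤_; _+_; z≤n; s≤s)
open import Data.Nat.Properties
  using (≤-reflexive; m≤m+n; m∸n+n≡m; +-mono-≤; +-monoˡ-≤; +-cancelˡ-≤; +-cancelʳ-≤;
         +-comm; +-commutativeSemigroup; module ≤-Reasoning)
open import Algebra.Properties.CommutativeSemigroup +-commutativeSemigroup using (interchange)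
open import Data.Fin using (Fin; zero; suc; _≟_)
open import Data.Fin.Subset using (Subset; _∪_; _∩_; ∁; ⊤; ⊥)
open import Data.Fin.Subset.Properties
  using (p∪∁p≡⊤; ∪-assoc; ∪-comm; ∪-idem; ∪-identityʳ; ∪-distribˡ-∩; ∪-∩-booleanAlgebra)
open import Algebra.Lattice.Properties.BooleanAlgebra using (deMorgan₁; deMorgan₂)
open import Data.Fin.Permutation using (Permutation′; _⟨$⟩ʳ_; transpose; _∘ₚ_)
import Data.Fin.Permutation.Components as PC
open import Data.Product using (Σ; _×_; _,_)
open import Function using (_∘_)
open import Relation.Nullary using (contradiction)
open import Relation.Nullary.Decidable using (dec-true; dec-false)
open import Relation.Binary.PropositionalEquality
  using (_≡_; _≢_; refl; sym; cong; cong₂; module ≡-Reasoning)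

∁-∪ : ∀ {m} (X Y : Subset m) → ∁ (X ∪ Y) ≡ ∁ X ∩ ∁ Y
∁-∪ = deMorgan₂ (∪-∩-booleanAlgebra _)

∁-∩ : ∀ {m} (X Y : Subset m) → ∁ (X ∩ Y) ≡ ∁ X ∪ ∁ Y
∁-∩ = deMorgan₁ (∪-∩-booleanAlgebra _)

∪-absorb-overlap : ∀ {m} (L a b : Subset m) → (L ∪ a) ∪ (a ∪ b) ≡ L ∪ (a ∪ b)
∪-absorb-overlap L a b = begin
  (L ∪ a) ∪ (a ∪ b)  ≡⟨ ∪-assoc L a (a ∪ b) ⟩
  L ∪ (a ∪ (a ∪ b))  ≡⟨ cong (L ∪_) (∪-assoc a a b) ⟨
  L ∪ ((a ∪ a) ∪ b)  ≡⟨ cong (λ x → L ∪ (x ∪ b)) (∪-idem a) ⟩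
  L ∪ (a ∪ b)        ∎
  where open ≡-Reasoning

∩-overlap-disjoint : ∀ {m} (L a b : Subset m) → L ∩ b ≡ ⊥ → (L ∪ a) ∩ (a ∪ b) ≡ a
∩-overlap-disjoint L a b L∩b≡⊥ = begin
  (L ∪ a) ∩ (a ∪ b)  ≡⟨ cong (_∩ (a ∪ b)) (∪-comm L a) ⟩
  (a ∪ L) ∩ (a ∪ b)  ≡⟨ ∪-distribˡ-∩ a L b ⟨
  a ∪ (L ∩ b)        ≡⟨ cong (a ∪_) L∩b≡⊥ ⟩
  a ∪ ⊥              ≡⟨ ∪-identityʳ a ⟩
  a                  ∎
  where open ≡-Reasoning

module _ {m : ℕ} (M : Matroid m) where
  open Matroid M

  -- λ₀ = λ + r(E); working with it avoids the truncated subtraction in conn.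
  λ₀ : Subset m → ℕ
  λ₀ X = r X + r (∁ X)

  r⊤≤λ₀ : ∀ X → r ⊤ ≤ λ₀ X
  r⊤≤λ₀ X = begin
    r ⊤                        ≡⟨ cong r (p∪∁p≡⊤ X) ⟨
    r (X ∪ ∁ X)                ≤⟨ m≤m+n _ _ ⟩
    r (X ∪ ∁ X) + r (X ∩ ∁ X)  ≤⟨ r-submod X (∁ X) ⟩
    λ₀ X                       ∎
    where open ≤-Reasoning

  conn+r⊤≡λ₀ : ∀ X → conn M X + r ⊤ ≡ λ₀ X
  conn+r⊤≡λ₀ X = m∸n+n≡m (r⊤≤λ₀ X)

  λ₀-submod : ∀ X Y → λ₀ (X ∪ Y) + λ₀ (X ∩ Y) ≤ λ₀ X + λ₀ Y
  λ₀-submod X Y = begin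
    λ₀ (X ∪ Y) + λ₀ (X ∩ Y)
      ≡⟨ interchange (r (X ∪ Y)) _ (r (X ∩ Y)) _ ⟩
    (r (X ∪ Y) + r (X ∩ Y)) + (r (∁ (X ∪ Y)) + r (∁ (X ∩ Y)))
      ≡⟨ cong₂ (λ U I → (r (X ∪ Y) + r (X ∩ Y)) + (r U + r I)) (∁-∪ X Y) (∁-∩ X Y) ⟩
    (r (X ∪ Y) + r (X ∩ Y)) + (r (∁ X ∩ ∁ Y) + r (∁ X ∪ ∁ Y))
      ≡⟨ cong ((r (X ∪ Y) + r (X ∩ Y)) +_) (+-comm (r (∁ X ∩ ∁ Y)) _) ⟩
    (r (X ∪ Y) + r (X ∩ Y)) + (r (∁ X ∪ ∁ Y) + r (∁ X ∩ ∁ Y))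
      ≤⟨ +-mono-≤ (r-submod X Y) (r-submod (∁ X) (∁ Y)) ⟩
    (r X + r Y) + (r (∁ X) + r (∁ Y))
      ≡⟨ interchange (r X) _ _ _ ⟩
    λ₀ X + λ₀ Y
      ∎
    where open ≤-Reasoning

  conn-submod : ∀ X Y → conn M (X ∪ Y) + conn M (X ∩ Y) ≤ conn M X + conn M Y
  conn-submod X Y = +-cancelʳ-≤ (r ⊤ + r ⊤) _ _ (begin
    (conn M (X ∪ Y) + conn M (X ∩ Y)) + (r ⊤ + r ⊤)
      ≡⟨ interchange (conn M (X ∪ Y)) _ _ _ ⟩
    (conn M (X ∪ Y) + r ⊤) + (conn M (X ∩ Y) + r ⊤)
      ≡⟨ cong₂ _+_ (conn+r⊤≡λ₀ (X ∪ Y)) (conn+r⊤≡λ₀ (X ∩ Y)) ⟩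
    λ₀ (X ∪ Y) + λ₀ (X ∩ Y)
      ≤⟨ λ₀-submod X Y ⟩
    λ₀ X + λ₀ Y
      ≡⟨ cong₂ _+_ (conn+r⊤≡λ₀ X) (conn+r⊤≡λ₀ Y) ⟨
    (conn M X + r ⊤) + (conn M Y + r ⊤)
      ≡⟨ interchange (conn M X) _ _ _ ⟩
    (conn M X + conn M Y) + (r ⊤ + r ⊤)
      ∎)
    where open ≤-Reasoning

  conn-∪-nondecreasing-restrict : ∀ L a b → L ∩ b ≡ ⊥ →
    conn M (L ∪ a) ≤ conn M (L ∪ (a ∪ b)) → conn M a ≤ conn M (a ∪ b)
  conn-∪-nondecreasing-restrict L a b L∩b≡⊥ L∪a≤L∪a∪b =
    +-cancelˡ-≤ (conn M (L ∪ (a ∪ b))) _ _ (begin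
      conn M (L ∪ (a ∪ b)) + conn M a
        ≡⟨ cong₂ (λ U I → conn M U + conn M I)
             (∪-absorb-overlap L a b) (∩-overlap-disjoint L a b L∩b≡⊥) ⟨
      conn M ((L ∪ a) ∪ (a ∪ b)) + conn M ((L ∪ a) ∩ (a ∪ b))
        ≤⟨ conn-submod (L ∪ a) (a ∪ b) ⟩
      conn M (L ∪ a) + conn M (a ∪ b)
        ≤⟨ +-monoˡ-≤ (conn M (a ∪ b)) L∪a≤L∪a∪b ⟩
      conn M (L ∪ (a ∪ b)) + conn M (a ∪ b)
        ∎)
    where open ≤-Reasoning

transpose-matchˡ : ∀ {n} (i j : Fin n) → PC.transpose i j i ≡ j
transpose-matchˡ i j rewrite dec-true (i ≟ i) refl = refl

transpose-fix : ∀ {n} (i j k : Fin n) → k ≢ i → k ≢ j → PC.transpose i j k ≡ k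
transpose-fix i j k k≢i k≢j rewrite dec-false (k ≟ i) k≢i | dec-false (k ≟ j) k≢j = refl

-- σ swaps 0 and i after first moving the preimage of j under that swap to 1.
permutation-starting-with : ∀ {n} (i j : Fin (suc (suc n))) → i ≢ j →
  Σ (Permutation′ (suc (suc n))) λ σ → σ ⟨$⟩ʳ zero ≡ i × σ ⟨$⟩ʳ suc zero ≡ j
permutation-starting-with {n} i j i≢j = σ , σ0≡i , σ1≡j
  where
  k : Fin (suc (suc n))
  k = PC.transpose i zero j
  σ : Permutation′ (suc (suc n))
  σ = transpose (suc zero) k ∘ₚ transpose zero i
  k≢0 : k ≢ zero
  k≢0 k≡0 = i≢j (begin
    i                          ≡⟨ transpose-matchˡ zero i ⟨
    PC.transpose zero i zero   ≡⟨ cong (PC.transpose zero i) k≡0 ⟨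
    PC.transpose zero i k      ≡⟨ PC.transpose-inverse zero i ⟩
    j                          ∎)
    where open ≡-Reasoning
  σ0≡i : σ ⟨$⟩ʳ zero ≡ i
  σ0≡i rewrite transpose-fix (suc zero) k zero (λ ()) (k≢0 ∘ sym) = transpose-matchˡ zero i
  σ1≡j : σ ⟨$⟩ʳ suc zero ≡ j
  σ1≡j rewrite transpose-matchˡ (suc zero) k = PC.transpose-inverse zero i

unionUpTo-zero : ∀ {m n} (P : Fin n → Subset m) → unionUpTo P 0 ≡ ⊥
unionUpTo-zero {n = 0}     P = refl
unionUpTo-zero {n = suc n} P = refl

unionUpTo-one : ∀ {m n} (P : Fin (suc n) → Subset m) → unionUpTo P 1 ≡ P zero
unionUpTo-one P rewrite unionUpTo-zero (λ k → P (suc k)) = ∪-identityʳ (P zero)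

unionUpTo-two : ∀ {m n} (P : Fin (suc (suc n)) → Subset m) →
  unionUpTo P 2 ≡ P zero ∪ P (suc zero)
unionUpTo-two P = cong (P zero ∪_) (unionUpTo-one (λ k → P (suc k)))

module _ {m n : ℕ} (M : Matroid m) {L R : Subset m} {P : Fin (suc (suc n)) → Subset m} where

  path-disjoint-second : IsPathOf4Seps M L P R → L ∩ P (suc zero) ≡ ⊥
  path-disjoint-second ((_ , L#P , _) , _) = L#P (suc zero)

  path-conn-first-two : IsPathOf4Seps M L P R →
    conn M (L ∪ P zero) ≡ conn M (L ∪ (P zero ∪ P (suc zero)))
  path-conn-first-two (_ , _ , seps) = begin
    conn M (L ∪ P zero)                   ≡⟨ cong (λ U → conn M (L ∪ U)) (unionUpTo-one P) ⟨
    conn M (L ∪ unionUpTo P 1)            ≡⟨ seps 1 (s≤s z≤n) ⟩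
    3                                     ≡⟨ seps 2 (s≤s (s≤s z≤n)) ⟨
    conn M (L ∪ unionUpTo P 2)            ≡⟨ cong (λ U → conn M (L ∪ U)) (unionUpTo-two P) ⟩
    conn M (L ∪ (P zero ∪ P (suc zero)))  ∎
    where open ≡-Reasoning

lemma2p3 : ∀ {m n} (M : Matroid m) (L R : Subset m) (Q : Fin n → Subset m) →
    Is4Flexipath M L Q R →
    ∀ (i j : Fin n) → i ≢ j →
    conn M (Q i) ≤ conn M (Q i ∪ Q j)
lemma2p3 {n = 1} M L R Q flexi zero zero i≢j = contradiction refl i≢j
lemma2p3 {n = suc (suc n)} M L R Q flexi i j i≢j
  with σ , σ0≡i , σ1≡j ← permutation-starting-with i j i≢j
  rewrite sym σ0≡i | sym σ1≡j =
  conn-∪-nondecreasing-restrict M L (Q (σ ⟨$⟩ʳ zero)) (Q (σ ⟨$⟩ʳ suc zero))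
    (path-disjoint-second M path) (≤-reflexive (path-conn-first-two M path))
  where
  path : IsPathOf4Seps M L (λ x → Q (σ ⟨$⟩ʳ x)) R
  path = flexi σ
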